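{- For all integers $p\geq 1$, $q\geq 1$ and $m\leq (q+1)p$ there is a bipartite graph $T$ with bipartition $C,D$ such that $C$ consists of $m$ vertices each of degree $q$, $D$ consists of $\binom{q+1}{2}$ vertices each of degree at most $2p$, and every pair of vertices in $C$ have a common neighbour in $D$. -}

module Defs where

open import Data.Nat using (ℕ; zero; suc; _+_)
open import Data.Bool using (Bool; true; false)
open import Data.Fin using (Fin)
import Data.Fin as F

countTrue : (n : ℕ) → (Fin n → Bool) → ℕ
countTrue zero    f = 0
countTrue (suc n) f with f F.zero
... | true  = suc (countTrue n (λ i → f (F.suc i)))
... | false = countTrue n (λ i → f (F.suc i))

-- A (simple) bipartite graph with parts C = Fin c and D = Fin d,
-- given by its biadjacency relation (edges only between C and D).
BipartiteGraph : ℕ → ℕ → Set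
BipartiteGraph c d = Fin c → Fin d → Bool

degC : ∀ {c d} → BipartiteGraph c d → Fin c → ℕ
degC {c} {d} T x = countTrue d (λ y → T x y)

degD : ∀ {c d} → BipartiteGraph c d → Fin d → ℕ
degD {c} {d} T y = countTrue c (λ x → T x y)

-- Take the vertex–edge incidence graph of the complete graph K_(q+1): every
-- vertex lies on q edges, every edge has 2 ends, and since q ≥ 1 any two
-- vertices (equal or not) lie on a common edge.  Replacing every vertex by p
-- copies multiplies the edge degrees by p, giving (q+1)p left vertices of
-- degree q and right degrees 2p; keeping any m of the copies preserves the
-- left degrees and common neighbours and can only lower the right degrees.
module Submission where

open import Defs
open import Data.Bool using (Bool; true; false)
open import Data.Fin using (Fin; zero; suc; inject≤; splitAt; quotient; _↑ˡ_; _↑ʳ_)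
open import Data.Fin.Properties using (_≟_)
open import Data.Nat using (ℕ; zero; suc; _+_; _*_; _≤_; _≥_; z≤n; s≤s)
open import Data.Nat.Combinatorics using (_C_; nC1≡n; nCk+nC[k+1]≡[n+1]C[k+1])
open import Data.Nat.Properties using (+-comm; +-identityʳ; *-distribʳ-+; ≤-trans; ≤-reflexive)
open import Data.Product using (∃-syntax; _×_; _,_)
open import Data.Sum using (inj₁; inj₂; [_,_]′)
open import Data.Sum.Properties using ([,]-map)
open import Data.Vec.Functional using (_++_; _∷_)
open import Data.Vec.Functional.Properties using (lookup-++ˡ; lookup-++ʳ)
open import Function using (_∘_; const)
open import Relation.Binary.PropositionalEquality
  using (_≡_; _≢_; refl; sym; trans; cong; cong₂; subst; module ≡-Reasoning)
open import Relation.Nullary using (does)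
open import Relation.Nullary.Decidable using (dec-true)

countTrue-cong : ∀ n {f g : Fin n → Bool} → (∀ i → f i ≡ g i) → countTrue n f ≡ countTrue n g
countTrue-cong zero    f≗g = refl
countTrue-cong (suc n) {f} {g} f≗g with f zero | g zero | f≗g zero
... | true  | .true  | refl = cong suc (countTrue-cong n (f≗g ∘ suc))
... | false | .false | refl = countTrue-cong n (f≗g ∘ suc)

countTrue-suc : ∀ n (f : Fin (suc n) → Bool) →
                countTrue (suc n) f ≡ countTrue 1 (const (f zero)) + countTrue n (f ∘ suc)
countTrue-suc n f with f zero
... | true  = refl
... | false = refl

countTrue-false : ∀ n → countTrue n (const false) ≡ 0
countTrue-false zero    = refl
countTrue-false (suc n) = countTrue-false n

countTrue-true : ∀ n → countTrue n (const true) ≡ n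
countTrue-true zero    = refl
countTrue-true (suc n) = cong suc (countTrue-true n)

countTrue-const : ∀ n b → countTrue n (const b) ≡ countTrue 1 (const b) * n
countTrue-const n true  = trans (countTrue-true n) (sym (+-identityʳ n))
countTrue-const n false = countTrue-false n

++-∘-suc : ∀ {A : Set} {m n} (f : Fin (suc m) → A) (g : Fin n → A) (i : Fin (m + n)) →
           (f ++ g) (suc i) ≡ ((f ∘ suc) ++ g) i
++-∘-suc {m = m} f g i = [,]-map (splitAt m i)

countTrue-++ : ∀ m {n} (f : Fin m → Bool) (g : Fin n → Bool) →
               countTrue (m + n) (f ++ g) ≡ countTrue m f + countTrue n g
countTrue-++ zero    f g = refl
countTrue-++ (suc m) f g with f zero
... | true  = cong suc (trans (countTrue-cong (m + _) (++-∘-suc f g)) (countTrue-++ m (f ∘ suc) g))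
... | false = trans (countTrue-cong (m + _) (++-∘-suc f g)) (countTrue-++ m (f ∘ suc) g)

countTrue-[i≟v] : ∀ {n} (v : Fin n) → countTrue n (λ i → does (i ≟ v)) ≡ 1
countTrue-[i≟v] {suc n} zero    = cong suc (countTrue-false n)
countTrue-[i≟v] {suc n} (suc v) = countTrue-[i≟v] v

countTrue-[v≟i] : ∀ {n} (v : Fin n) → countTrue n (λ i → does (v ≟ i)) ≡ 1
countTrue-[v≟i] {suc n} zero    = cong suc (countTrue-false n)
countTrue-[v≟i] {suc n} (suc v) = countTrue-[v≟i] v

∘-quotient-suc : ∀ {m} p (f : Fin (suc m) → Bool) (i : Fin (suc m * p)) →
                 f (quotient p i) ≡ (const (f zero) ++ (f ∘ suc ∘ quotient {m} p)) i
∘-quotient-suc p f i with splitAt p i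
... | inj₁ _ = refl
... | inj₂ _ = refl

countTrue-∘-quotient : ∀ m p (f : Fin m → Bool) →
                       countTrue (m * p) (f ∘ quotient p) ≡ countTrue m f * p
countTrue-∘-quotient zero    p f = refl
countTrue-∘-quotient (suc m) p f = begin
  countTrue (p + m * p) (f ∘ quotient p)
    ≡⟨ countTrue-cong (p + m * p) (∘-quotient-suc p f) ⟩
  countTrue (p + m * p) (const (f zero) ++ (f ∘ suc ∘ quotient {m} p))
    ≡⟨ countTrue-++ p (const (f zero)) (f ∘ suc ∘ quotient {m} p) ⟩
  countTrue p (const (f zero)) + countTrue (m * p) (f ∘ suc ∘ quotient {m} p)
    ≡⟨ cong₂ _+_ (countTrue-const p (f zero)) (countTrue-∘-quotient m p (f ∘ suc)) ⟩
  countTrue 1 (const (f zero)) * p + countTrue m (f ∘ suc) * p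
    ≡⟨ *-distribʳ-+ p (countTrue 1 (const (f zero))) (countTrue m (f ∘ suc)) ⟨
  (countTrue 1 (const (f zero)) + countTrue m (f ∘ suc)) * p
    ≡⟨ cong (_* p) (countTrue-suc m f) ⟨
  countTrue (suc m) f * p ∎
  where open ≡-Reasoning

countTrue-∘-inject≤ : ∀ {m n} (m≤n : m ≤ n) (f : Fin n → Bool) →
                      countTrue m (λ i → f (inject≤ i m≤n)) ≤ countTrue n f
countTrue-∘-inject≤ {zero}          m≤n       f = z≤n
countTrue-∘-inject≤ {suc m} {suc n} (s≤s m≤n) f with f zero
... | true  = s≤s (countTrue-∘-inject≤ m≤n (f ∘ suc))
... | false = countTrue-∘-inject≤ m≤n (f ∘ suc)

choose2 : ℕ → ℕ
choose2 zero    = 0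
choose2 (suc n) = n + choose2 n

choose2≡C2 : ∀ n → choose2 n ≡ n C 2
choose2≡C2 zero    = refl
choose2≡C2 (suc n) =
  trans (cong₂ _+_ (sym (nC1≡n n)) (choose2≡C2 n)) (nCk+nC[k+1]≡[n+1]C[k+1] n 1)

-- The vertex–edge incidence graph of K_n.  The edges of K_(n+1) are listed
-- as the n edges {0, i+1}, followed by the edges of K_n on the vertices 1 … n.
incidence : ∀ n → BipartiteGraph n (choose2 n)
incidence (suc n) zero    e = [ const true , const false ]′ (splitAt n e)
incidence (suc n) (suc v) e = [ (λ i → does (i ≟ v)) , incidence n v ]′ (splitAt n e)

degC-incidence : ∀ n (v : Fin (suc n)) → degC (incidence (suc n)) v ≡ n
degC-incidence n zero = begin
  degC (incidence (suc n)) zero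
    ≡⟨ countTrue-++ n (const true) (const false) ⟩
  countTrue n (const true) + countTrue (choose2 n) (const false)
    ≡⟨ cong₂ _+_ (countTrue-true n) (countTrue-false (choose2 n)) ⟩
  n + 0
    ≡⟨ +-identityʳ n ⟩
  n ∎
  where open ≡-Reasoning
degC-incidence (suc n) (suc v) =
  trans (countTrue-++ (suc n) (λ i → does (i ≟ v)) (incidence (suc n) v))
        (cong₂ _+_ (countTrue-[i≟v] v) (degC-incidence n v))

degD-incidence : ∀ n (e : Fin (choose2 n)) → degD (incidence n) e ≡ 2
degD-incidence (suc n) e = byBlock (splitAt n e) refl
  where
  byBlock : ∀ s → splitAt n e ≡ s → degD (incidence (suc n)) e ≡ 2
  byBlock (inj₁ i) eq = trans (countTrue-cong (suc n) column) (cong suc (countTrue-[v≟i] i))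
    where
    column : ∀ v → incidence (suc n) v e ≡ (true ∷ λ v → does (i ≟ v)) v
    column zero    = cong [ const true , const false ]′ eq
    column (suc v) = cong [ (λ k → does (k ≟ v)) , incidence n v ]′ eq
  byBlock (inj₂ j) eq = trans (countTrue-cong (suc n) column) (degD-incidence n j)
    where
    column : ∀ v → incidence (suc n) v e ≡ (false ∷ λ v → incidence n v j) v
    column zero    = cong [ const true , const false ]′ eq
    column (suc v) = cong [ (λ k → does (k ≟ v)) , incidence n v ]′ eq

incidence-zero-↑ˡ : ∀ {n} (i : Fin n) → incidence (suc n) zero (i ↑ˡ choose2 n) ≡ true
incidence-zero-↑ˡ {n} i = lookup-++ˡ {m = n} (const true) (const false) i

incidence-suc-↑ˡ : ∀ {n} (i : Fin n) → incidence (suc n) (suc i) (i ↑ˡ choose2 n) ≡ true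
incidence-suc-↑ˡ {n} i =
  trans (lookup-++ˡ {m = n} (λ k → does (k ≟ i)) (incidence n i) i) (dec-true (i ≟ i) refl)

incidence-suc-↑ʳ : ∀ {n} (v : Fin n) (e : Fin (choose2 n)) →
                   incidence (suc n) (suc v) (n ↑ʳ e) ≡ incidence n v e
incidence-suc-↑ʳ {n} v e = lookup-++ʳ {m = n} (λ k → does (k ≟ v)) (incidence n v) e

incidence-common : ∀ n (v w : Fin (suc (suc n))) →
                   ∃[ e ] (incidence (suc (suc n)) v e ≡ true × incidence (suc (suc n)) w e ≡ true)
incidence-common n       zero       zero       = zero , refl , refl
incidence-common n       zero       (suc w)    = w ↑ˡ _ , incidence-zero-↑ˡ w , incidence-suc-↑ˡ w
incidence-common n       (suc v)    zero       = v ↑ˡ _ , incidence-suc-↑ˡ v , incidence-zero-↑ˡ v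
incidence-common zero    (suc zero) (suc zero) = zero , refl , refl
incidence-common (suc n) (suc v)    (suc w)    with incidence-common n v w
... | e , v∈e , w∈e = suc (suc n) ↑ʳ e , trans (incidence-suc-↑ʳ v e) v∈e , trans (incidence-suc-↑ʳ w e) w∈e

-- Vertex x of the blow-up is a copy of vertex ⌊x/p⌋.
blowUp : ∀ {n d} m p → m ≤ n * p → BipartiteGraph n d → BipartiteGraph m d
blowUp m p m≤np G x = G (quotient p (inject≤ x m≤np))

degD-blowUp : ∀ {n d} m p (m≤np : m ≤ n * p) (G : BipartiteGraph n d) y →
              degD (blowUp m p m≤np G) y ≤ degD G y * p
degD-blowUp {n} m p m≤np G y =
  ≤-trans (countTrue-∘-inject≤ m≤np (λ x → G (quotient p x) y))
          (≤-reflexive (countTrue-∘-quotient n p (λ v → G v y)))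

PairCovering : (m d q r : ℕ) → Set
PairCovering m d q r =
  ∃[ T ] ((∀ (x : Fin m) → degC {m} {d} T x ≡ q)
    × (∀ (y : Fin d) → degD {m} {d} T y ≤ r)
    × (∀ (x x′ : Fin m) → x ≢ x′ → ∃[ y ] (T x y ≡ true × T x′ y ≡ true)))

blowUp-incidence-pairCovering : ∀ n p m → m ≤ suc (suc n) * p →
                                PairCovering m (choose2 (suc (suc n))) (suc n) (2 * p)
blowUp-incidence-pairCovering n p m m≤np =
  blowUp {suc (suc n)} m p m≤np (incidence _) , degC-incidence (suc n) ∘ vertex , degD≤2p , common
  where
  vertex : Fin m → Fin (suc (suc n))
  vertex x = quotient p (inject≤ x m≤np)
  degD≤2p : ∀ e → degD (blowUp m p m≤np (incidence _)) e ≤ 2 * p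
  degD≤2p e = ≤-trans (degD-blowUp m p m≤np (incidence _) e)
                      (≤-reflexive (cong (_* p) (degD-incidence (suc (suc n)) e)))
  common : ∀ x x′ → x ≢ x′ → ∃[ e ] (incidence _ (vertex x) e ≡ true × incidence _ (vertex x′) e ≡ true)
  common x x′ _ = incidence-common n (vertex x) (vertex x′)

mainTheorem14 : (p q m : ℕ) → p ≥ 1 → q ≥ 1 → m ≤ (q + 1) * p →
    ∃[ T ] ((∀ (x : Fin m) → degC {m} {(q + 1) C 2} T x ≡ q)
    × (∀ (y : Fin ((q + 1) C 2)) → degD {m} {(q + 1) C 2} T y ≤ 2 * p)
    × (∀ (x x′ : Fin m) → x ≢ x′ → ∃[ y ] (T x y ≡ true × T x′ y ≡ true)))
mainTheorem14 p zero    m _ () _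
mainTheorem14 p (suc n) m _ _  m≤[q+1]p =
  subst (λ d → PairCovering m d (suc n) (2 * p)) choose2[q+1]≡[q+1]C2
    (blowUp-incidence-pairCovering n p m (subst (λ k → m ≤ k * p) (+-comm (suc n) 1) m≤[q+1]p))
  where
  choose2[q+1]≡[q+1]C2 : choose2 (suc (suc n)) ≡ (suc n + 1) C 2
  choose2[q+1]≡[q+1]C2 = trans (choose2≡C2 (suc (suc n))) (cong (_C 2) (+-comm 1 (suc n)))
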